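{- Let $n\geq 3$ and $3\leq k\leq 2^{n-1}$, and write $k=3q_k+r_k$ with integers $q_k\geq 0$ and $0\leq r_k\leq 2$. Let $P_k$ be a path with $k$ vertices in $Q_n$. If $u$ and $v$ are adjacent vertices of $Q_n-V(P_k)$, then $|N_{Q_n}(\{u,v\})\cap V(P_k)|\leq 2q_k+r_k$. In particular, $|N_{Q_n}(\{u,v\})\cap V(P_k)|\leq k-1$.
   Context: $Q_n$ is the $n$-dimensional hypercube: its vertices are the binary strings of length $n$, two vertices being adjacent iff they differ in exactly one position. For a vertex set $S$, $N_{Q_n}(S)$ denotes the set of vertices of $Q_n$ adjacent to some vertex of $S$. -}

module Defs where

open import Data.Bool using (Bool)
open import Data.Nat using (ℕ; zero; suc)
open import Data.Nat.Properties using (_≟_)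
open import Data.Vec using (Vec; []; _∷_)
open import Data.List using (List; filter; length)
open import Data.List.Membership.Propositional using (_∈_)
open import Data.List.Relation.Unary.Unique.Propositional using (Unique)
open import Data.List.Relation.Unary.Linked using (Linked)
open import Data.Product using (_×_)
open import Data.Sum using (_⊎_)
open import Relation.Binary.PropositionalEquality using (_≡_)
open import Relation.Nullary using (Dec; ¬_)
open import Relation.Nullary.Decidable using (_⊎-dec_)
open import Relation.Binary.Definitions using (Decidable)

Vertex : ℕ → Set
Vertex n = Vec Bool n

hamming : ∀ {n} → Vertex n → Vertex n → ℕ
hamming [] [] = zero
hamming (Bool.false ∷ xs) (Bool.false ∷ ys) = hamming xs ys
hamming (Bool.true ∷ xs) (Bool.true ∷ ys) = hamming xs ys
hamming (_ ∷ xs) (_ ∷ ys) = suc (hamming xs ys)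

Adjacent : ∀ {n} → Vertex n → Vertex n → Set
Adjacent x y = hamming x y ≡ 1

adjacent? : ∀ {n} → Decidable (Adjacent {n})
adjacent? x y = hamming x y ≟ 1

IsPath : ∀ {n} → ℕ → List (Vertex n) → Set
IsPath k P = (length P ≡ k) × Unique P × Linked Adjacent P

-- |N_{Q_n}({u,v}) ∩ V(P)|: the number of vertices of P adjacent to u or to v
-- (P has no repeated vertices, so counting list entries counts vertices).
nbrCount : ∀ {n} → Vertex n → Vertex n → List (Vertex n) → ℕ
nbrCount u v P = length (filter (λ x → adjacent? x u ⊎-dec adjacent? x v) P)

-- The cube Q_n is bipartite, hence triangle-free, and two distinct vertices of Q_n
-- have at most two common neighbours.  Let a b c be consecutive vertices of P and
-- suppose all three lie in N({u,v}); say b ~ u.  Triangle-freeness forbids a ~ u and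
-- c ~ u, so a ~ v and c ~ v, and then b and v have the three common neighbours a, c, u.
-- So every three consecutive vertices of P contain at most two vertices of N({u,v}),
-- and cutting P into q blocks of three and a remainder of r vertices gives 2q + r.
module Submission where

open import Defs
open import Data.Nat using (ℕ; _+_; _*_; _∸_; _^_; _≤_; zero; suc; s≤s)
open import Data.Nat.Properties
  using ( module ≤-Reasoning; suc-injective; ≤-refl; ≤-trans; n≤1+n; n<1+n
        ; +-monoʳ-≤; +-monoˡ-<; *-monoˡ-<; *-suc; +-assoc; <⇒≤pred; <⇒≱)
open import Data.Bool using (Bool; true; false; not; _xor_)
open import Data.Bool.Properties using (not-involutive; not-¬) renaming (_≟_ to _≟ᵇ_)
open import Data.Vec using ([]; _∷_)
open import Data.List using (List; []; _∷_; length; filter)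
open import Data.List.Properties using (length-filter; filter-reject)
open import Data.List.Membership.Propositional using (_∉_)
open import Data.List.Relation.Unary.Any using (here; there)
open import Data.List.Relation.Unary.All using (_∷_)
open import Data.List.Relation.Unary.AllPairs using (_∷_)
open import Data.List.Relation.Unary.Linked using (Linked; _∷_)
import Data.List.Relation.Unary.Linked as Linked
open import Data.List.Relation.Unary.Unique.Propositional using (Unique)
open import Data.Product using (_×_; _,_; proj₁)
open import Data.Sum using (_⊎_; inj₁; inj₂; swap)
open import Data.Unit using (⊤; tt)
open import Data.Empty using (⊥; ⊥-elim)
open import Function using (_∘_)
open import Level using (0ℓ)
open import Relation.Nullary using (¬_; yes; no; Dec)
open import Relation.Nullary.Decidable using (_⊎-dec_)
open import Relation.Unary using (Pred; Decidable)
open import Relation.Binary.PropositionalEquality using (_≡_; _≢_; refl; sym; trans; cong)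

hamming≡0⇒≡ : ∀ {n} (x y : Vertex n) → hamming x y ≡ 0 → x ≡ y
hamming≡0⇒≡ [] [] _ = refl
hamming≡0⇒≡ (false ∷ x) (false ∷ y) h = cong (false ∷_) (hamming≡0⇒≡ x y h)
hamming≡0⇒≡ (true ∷ x) (true ∷ y) h = cong (true ∷_) (hamming≡0⇒≡ x y h)

hamming-sym : ∀ {n} (x y : Vertex n) → hamming x y ≡ hamming y x
hamming-sym [] [] = refl
hamming-sym (false ∷ x) (false ∷ y) = hamming-sym x y
hamming-sym (true ∷ x) (true ∷ y) = hamming-sym x y
hamming-sym (false ∷ x) (true ∷ y) = cong suc (hamming-sym x y)
hamming-sym (true ∷ x) (false ∷ y) = cong suc (hamming-sym x y)

Adjacent-sym : ∀ {n} (x y : Vertex n) → Adjacent x y → Adjacent y x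
Adjacent-sym x y xy = trans (hamming-sym y x) xy

parity : ∀ {n} → Vertex n → Bool
parity [] = false
parity (b ∷ x) = b xor parity x

Adjacent⇒parity-flips : ∀ {n} (x y : Vertex n) → Adjacent x y → parity y ≡ not (parity x)
Adjacent⇒parity-flips [] [] ()
Adjacent⇒parity-flips (false ∷ x) (false ∷ y) xy = Adjacent⇒parity-flips x y xy
Adjacent⇒parity-flips (true ∷ x) (true ∷ y) xy = cong not (Adjacent⇒parity-flips x y xy)
Adjacent⇒parity-flips (false ∷ x) (true ∷ y) xy =
  cong (λ z → not (parity z)) (sym (hamming≡0⇒≡ x y (suc-injective xy)))
Adjacent⇒parity-flips (true ∷ x) (false ∷ y) xy =
  trans (cong parity (sym (hamming≡0⇒≡ x y (suc-injective xy)))) (sym (not-involutive _))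

triangle-free : ∀ {n} (x y z : Vertex n) → Adjacent x y → Adjacent y z → ¬ Adjacent x z
triangle-free x y z xy yz xz = not-¬ parity-z≡parity-x (Adjacent⇒parity-flips x z xz)
  where
  open Relation.Binary.PropositionalEquality.≡-Reasoning
  parity-z≡parity-x : parity z ≡ parity x
  parity-z≡parity-x = begin
    parity z             ≡⟨ Adjacent⇒parity-flips y z yz ⟩
    not (parity y)       ≡⟨ cong not (Adjacent⇒parity-flips x y xy) ⟩
    not (not (parity x)) ≡⟨ not-involutive _ ⟩
    parity x             ∎

*-suc-+ : ∀ m q r → m * suc q + r ≡ m + (m * q + r)
*-suc-+ m q r = trans (cong (_+ r) (*-suc m q)) (+-assoc m (m * q) r)

TwoEqual : {A : Set} → A → A → A → Set
TwoEqual a b c = a ≡ b ⊎ a ≡ c ⊎ b ≡ c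

pigeonhole : {A : Set} {x y a b c : A} →
             a ≡ x ⊎ a ≡ y → b ≡ x ⊎ b ≡ y → c ≡ x ⊎ c ≡ y → TwoEqual a b c
pigeonhole (inj₁ a≡x) (inj₁ b≡x) _ = inj₁ (trans a≡x (sym b≡x))
pigeonhole (inj₂ a≡y) (inj₂ b≡y) _ = inj₁ (trans a≡y (sym b≡y))
pigeonhole (inj₁ a≡x) _ (inj₁ c≡x) = inj₂ (inj₁ (trans a≡x (sym c≡x)))
pigeonhole (inj₂ a≡y) _ (inj₂ c≡y) = inj₂ (inj₁ (trans a≡y (sym c≡y)))
pigeonhole (inj₁ _) (inj₂ b≡y) (inj₂ c≡y) = inj₂ (inj₂ (trans b≡y (sym c≡y)))
pigeonhole (inj₂ _) (inj₁ b≡x) (inj₁ c≡x) = inj₂ (inj₂ (trans b≡x (sym c≡x)))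

TwoEqual-∷ : ∀ {n} p {a b c : Vertex n} → TwoEqual a b c → TwoEqual (p ∷ a) (p ∷ b) (p ∷ c)
TwoEqual-∷ p (inj₁ e) = inj₁ (cong (p ∷_) e)
TwoEqual-∷ p (inj₂ (inj₁ e)) = inj₂ (inj₁ (cong (p ∷_) e))
TwoEqual-∷ p (inj₂ (inj₂ e)) = inj₂ (inj₂ (cong (p ∷_) e))

-- A common neighbour of x and y whose first coordinates differ flips one of them,
-- so it agrees with one of x, y in the head and with the other in the tail.
common-neighbour-split : ∀ {n} {p q w} (x y z : Vertex n) → p ≢ q →
                         Adjacent (w ∷ z) (p ∷ x) → Adjacent (w ∷ z) (q ∷ y) →
                         w ∷ z ≡ p ∷ y ⊎ w ∷ z ≡ q ∷ x
common-neighbour-split {p = false} {false} _ _ _ p≢q _ _ = ⊥-elim (p≢q refl)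
common-neighbour-split {p = true} {true} _ _ _ p≢q _ _ = ⊥-elim (p≢q refl)
common-neighbour-split {p = false} {true} {false} x y z _ _ zy =
  inj₁ (cong (false ∷_) (hamming≡0⇒≡ z y (suc-injective zy)))
common-neighbour-split {p = true} {false} {true} x y z _ _ zy =
  inj₁ (cong (true ∷_) (hamming≡0⇒≡ z y (suc-injective zy)))
common-neighbour-split {p = false} {true} {true} x y z _ zx _ =
  inj₂ (cong (true ∷_) (hamming≡0⇒≡ z x (suc-injective zx)))
common-neighbour-split {p = true} {false} {false} x y z _ zx _ =
  inj₂ (cong (false ∷_) (hamming≡0⇒≡ z x (suc-injective zx)))

common-neighbour-tail : ∀ {n} {p w} (x y z : Vertex n) → x ≢ y →
                        Adjacent (w ∷ z) (p ∷ x) → Adjacent (w ∷ z) (p ∷ y) →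
                        w ≡ p × Adjacent z x × Adjacent z y
common-neighbour-tail {p = false} {false} x y z _ zx zy = refl , zx , zy
common-neighbour-tail {p = true} {true} x y z _ zx zy = refl , zx , zy
common-neighbour-tail {p = false} {true} x y z x≢y zx zy =
  ⊥-elim (x≢y (trans (sym (hamming≡0⇒≡ z x (suc-injective zx)))
                     (hamming≡0⇒≡ z y (suc-injective zy))))
common-neighbour-tail {p = true} {false} x y z x≢y zx zy =
  ⊥-elim (x≢y (trans (sym (hamming≡0⇒≡ z x (suc-injective zx)))
                     (hamming≡0⇒≡ z y (suc-injective zy))))

at-most-two-common-neighbours :
  ∀ {n} (x y a b c : Vertex n) → x ≢ y →
  Adjacent a x → Adjacent a y → Adjacent b x → Adjacent b y → Adjacent c x → Adjacent c y →
  TwoEqual a b c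
at-most-two-common-neighbours [] [] [] [] [] _ _ _ _ _ _ _ = inj₁ refl
at-most-two-common-neighbours (p ∷ x) (q ∷ y) (a₀ ∷ a) (b₀ ∷ b) (c₀ ∷ c) x≢y ax ay bx by cx cy
  with p ≟ᵇ q
... | no p≢q = pigeonhole (common-neighbour-split x y a p≢q ax ay)
                          (common-neighbour-split x y b p≢q bx by)
                          (common-neighbour-split x y c p≢q cx cy)
... | yes refl
  with common-neighbour-tail {w = a₀} x y a (x≢y ∘ cong (p ∷_)) ax ay
     | common-neighbour-tail {w = b₀} x y b (x≢y ∘ cong (p ∷_)) bx by
     | common-neighbour-tail {w = c₀} x y c (x≢y ∘ cong (p ∷_)) cx cy
... | refl , ax′ , ay′ | refl , bx′ , by′ | refl , cx′ , cy′ =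
  TwoEqual-∷ p
    (at-most-two-common-neighbours x y a b c (x≢y ∘ cong (p ∷_)) ax′ ay′ bx′ by′ cx′ cy′)

InNbhd : ∀ {n} → Vertex n → Vertex n → Pred (Vertex n) 0ℓ
InNbhd u v x = Adjacent x u ⊎ Adjacent x v

inNbhd? : ∀ {n} (u v : Vertex n) → Decidable (InNbhd u v)
inNbhd? u v x = adjacent? x u ⊎-dec adjacent? x v

window-not-in-nbhd-middle-adj : ∀ {n} (u v a b c : Vertex n) → Adjacent u v →
                   Adjacent a b → Adjacent b c → a ≢ c → u ≢ a → u ≢ c → v ≢ b →
                   Adjacent b u → InNbhd u v a → InNbhd u v c → ⊥
window-not-in-nbhd-middle-adj u v a b c _ ab _ _ _ _ _ bu (inj₁ au) _ =
  triangle-free a b u ab bu au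
window-not-in-nbhd-middle-adj u v a b c _ _ bc _ _ _ _ bu _ (inj₁ cu) =
  triangle-free c b u (Adjacent-sym b c bc) bu cu
window-not-in-nbhd-middle-adj u v a b c uv ab bc a≢c u≢a u≢c v≢b bu (inj₂ av) (inj₂ cv)
  with at-most-two-common-neighbours v b a c u v≢b av ab cv (Adjacent-sym b c bc) uv (Adjacent-sym b u bu)
... | inj₁ a≡c = a≢c a≡c
... | inj₂ (inj₁ a≡u) = u≢a (sym a≡u)
... | inj₂ (inj₂ c≡u) = u≢c (sym c≡u)

window-not-in-nbhd : ∀ {n} (u v a b c : Vertex n) → Adjacent u v →
                     Adjacent a b → Adjacent b c → a ≢ c →
                     u ≢ a → u ≢ b → u ≢ c → v ≢ a → v ≢ b → v ≢ c →
                     ¬ (InNbhd u v a × InNbhd u v b × InNbhd u v c)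
window-not-in-nbhd u v a b c uv ab bc a≢c u≢a _ u≢c _ v≢b _ (Na , inj₁ bu , Nc) =
  window-not-in-nbhd-middle-adj u v a b c uv ab bc a≢c u≢a u≢c v≢b bu Na Nc
window-not-in-nbhd u v a b c uv ab bc a≢c _ u≢b _ v≢a _ v≢c (Na , inj₂ bv , Nc) =
  window-not-in-nbhd-middle-adj v u a b c (Adjacent-sym u v uv) ab bc a≢c v≢a v≢c u≢b bv
    (swap Na) (swap Nc)

NoThreeConsecutive : {A : Set} → Pred A 0ℓ → List A → Set
NoThreeConsecutive P (a ∷ b ∷ c ∷ xs) = ¬ (P a × P b × P c) × NoThreeConsecutive P (b ∷ c ∷ xs)
NoThreeConsecutive P _ = ⊤

NoThreeConsecutive-drop3 : ∀ {A : Set} {P : Pred A 0ℓ} a b c xs →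
                           NoThreeConsecutive P (a ∷ b ∷ c ∷ xs) → NoThreeConsecutive P xs
NoThreeConsecutive-drop3 _ _ _ [] _ = tt
NoThreeConsecutive-drop3 _ _ _ (_ ∷ []) _ = tt
NoThreeConsecutive-drop3 _ _ _ (_ ∷ _ ∷ []) _ = tt
NoThreeConsecutive-drop3 _ _ _ (_ ∷ _ ∷ _ ∷ _) (_ , _ , _ , noThree) = noThree

path-window-not-in-nbhd : ∀ {n} (u v : Vertex n) → Adjacent u v → (P : List (Vertex n)) →
                          Unique P → Linked Adjacent P → u ∉ P → v ∉ P →
                          NoThreeConsecutive (InNbhd u v) P
path-window-not-in-nbhd u v uv [] _ _ _ _ = tt
path-window-not-in-nbhd u v uv (_ ∷ []) _ _ _ _ = tt
path-window-not-in-nbhd u v uv (_ ∷ _ ∷ []) _ _ _ _ = tt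
path-window-not-in-nbhd u v uv (a ∷ b ∷ c ∷ P) ((_ ∷ a≢c ∷ _) ∷ unique) (ab ∷ linked) u∉ v∉ =
  window-not-in-nbhd u v a b c uv ab (Linked.head linked) a≢c
    (u∉ ∘ here) (u∉ ∘ there ∘ here) (u∉ ∘ there ∘ there ∘ here)
    (v∉ ∘ here) (v∉ ∘ there ∘ here) (v∉ ∘ there ∘ there ∘ here)
  , path-window-not-in-nbhd u v uv (b ∷ c ∷ P) unique linked (u∉ ∘ there) (v∉ ∘ there)

module _ {A : Set} {P : Pred A 0ℓ} (P? : Decidable P) where

  count : List A → ℕ
  count xs = length (filter P? xs)

  count-∷-≤ : ∀ a xs → count (a ∷ xs) ≤ suc (count xs)
  count-∷-≤ a xs with P? a
  ... | yes _ = ≤-refl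
  ... | no _ = n≤1+n _

  count-∷-reject : ∀ {a} xs → ¬ P a → count (a ∷ xs) ≡ count xs
  count-∷-reject xs ¬Pa = cong length (filter-reject P? {xs = xs} ¬Pa)

  count-window-≤ : ∀ a b c xs → ¬ (P a × P b × P c) → count (a ∷ b ∷ c ∷ xs) ≤ 2 + count xs
  count-window-≤ a b c xs noThree = by-cases (P? a) (P? b) (P? c)
    where
    open ≤-Reasoning
    by-cases : Dec (P a) → Dec (P b) → Dec (P c) → count (a ∷ b ∷ c ∷ xs) ≤ 2 + count xs
    by-cases (no ¬Pa) _ _ = begin
      count (a ∷ b ∷ c ∷ xs)    ≡⟨ count-∷-reject (b ∷ c ∷ xs) ¬Pa ⟩
      count (b ∷ c ∷ xs)        ≤⟨ count-∷-≤ b (c ∷ xs) ⟩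
      suc (count (c ∷ xs))      ≤⟨ s≤s (count-∷-≤ c xs) ⟩
      2 + count xs              ∎
    by-cases (yes _) (no ¬Pb) _ = begin
      count (a ∷ b ∷ c ∷ xs)    ≤⟨ count-∷-≤ a (b ∷ c ∷ xs) ⟩
      suc (count (b ∷ c ∷ xs))  ≡⟨ cong suc (count-∷-reject (c ∷ xs) ¬Pb) ⟩
      suc (count (c ∷ xs))      ≤⟨ s≤s (count-∷-≤ c xs) ⟩
      2 + count xs              ∎
    by-cases (yes _) (yes _) (no ¬Pc) = begin
      count (a ∷ b ∷ c ∷ xs)    ≤⟨ count-∷-≤ a (b ∷ c ∷ xs) ⟩
      suc (count (b ∷ c ∷ xs))  ≤⟨ s≤s (count-∷-≤ b (c ∷ xs)) ⟩
      2 + count (c ∷ xs)        ≡⟨ cong (2 +_) (count-∷-reject xs ¬Pc) ⟩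
      2 + count xs              ∎
    by-cases (yes Pa) (yes Pb) (yes Pc) = ⊥-elim (noThree (Pa , Pb , Pc))

  count-≤-blocks : ∀ q r xs → length xs ≡ 3 * q + r → NoThreeConsecutive P xs →
                   count xs ≤ 2 * q + r
  count-≤-blocks zero r xs refl _ = length-filter P? xs
  count-≤-blocks (suc q) r xs len = peel xs (trans len (*-suc-+ 3 q r))
    where
    open ≤-Reasoning
    peel : ∀ xs → length xs ≡ 3 + (3 * q + r) → NoThreeConsecutive P xs → count xs ≤ 2 * suc q + r
    peel (a ∷ b ∷ c ∷ xs) len′ noThree = begin
      count (a ∷ b ∷ c ∷ xs)  ≤⟨ count-window-≤ a b c xs (proj₁ noThree) ⟩
      2 + count xs            ≤⟨ +-monoʳ-≤ 2 (count-≤-blocks q r xs length-xs noThree-xs) ⟩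
      2 + (2 * q + r)         ≡⟨ *-suc-+ 2 q r ⟨
      2 * suc q + r           ∎
      where
      length-xs : length xs ≡ 3 * q + r
      length-xs = suc-injective (suc-injective (suc-injective len′))
      noThree-xs : NoThreeConsecutive P xs
      noThree-xs = NoThreeConsecutive-drop3 a b c xs noThree

blocks-≤-pred : ∀ q r → r ≤ 2 → 3 ≤ 3 * q + r → 2 * q + r ≤ 3 * q + r ∸ 1
blocks-≤-pred zero r r≤2 3≤r = ⊥-elim (<⇒≱ 3≤r r≤2)
blocks-≤-pred (suc q) r _ _ = <⇒≤pred (+-monoˡ-< r (*-monoˡ-< (suc q) (n<1+n 2)))

lemma11 : (n k : ℕ) → 3 ≤ n → 3 ≤ k → k ≤ 2 ^ (n ∸ 1) →
            (q r : ℕ) → r ≤ 2 → k ≡ 3 * q + r →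
            (P : List (Vertex n)) → IsPath k P →
            (u v : Vertex n) → u ∉ P → v ∉ P → Adjacent u v →
            (nbrCount u v P ≤ 2 * q + r) × (nbrCount u v P ≤ k ∸ 1)
lemma11 n k _ 3≤k _ q r r≤2 refl P (length≡k , unique , linked) u v u∉P v∉P uv =
  count≤2q+r , ≤-trans count≤2q+r (blocks-≤-pred q r r≤2 3≤k)
  where
  count≤2q+r : nbrCount u v P ≤ 2 * q + r
  count≤2q+r = count-≤-blocks (inNbhd? u v) q r P length≡k
                 (path-window-not-in-nbhd u v uv P unique linked u∉P v∉P)
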